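{- Let $n\ge 3$ and $1\le k\le n$. A position $\mathbf p=(p_1,\dots,p_n)$ of $SN(n,k)$, with $p_n=\max_i p_i$, is reduced if and only if $p_n\le \Sigma(\mathbf p)/k$.
   Context: For an integer $n\ge 1$ and a nonempty set $A\subseteq\{1,\dots,n\}$, the game $SN(n,A)$ is played on $n$ stacks of tokens; a position is $\mathbf p=(p_1,\dots,p_n)$ of nonnegative integers, in non-decreasing order so $p_n=\max_i p_i$. A move consists of choosing some $\ell\in A$ and $\ell$ distinct stacks, each of height at least $1$, and removing exactly one token from each. $SN(n,k)$ denotes $SN(n,\{k\})$, and $\Sigma(\mathbf p)=\sum_i p_i$. A terminal position is one with no legal move. For a position $\mathbf p$, let $\mathcal T(\mathbf p)$ be the set of terminal positions reachable from $\mathbf p$ by finite sequences of legal moves, $u_i(\mathbf p)=\min\{t_i:\mathbf t\in\mathcal T(\mathbf p)\}$, and $r(\mathbf p)=\mathbf p-u(\mathbf p)$. The position $\mathbf p$ is reduced if $r(\mathbf p)=\mathbf p$. -}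

module Defs where

open import Data.Nat using (ℕ; zero; suc; _+_; _*_; _∸_; _≤_)
open import Data.Bool using (Bool; true; false; if_then_else_)
open import Data.Fin using (Fin)
import Data.Fin as F
open import Data.Fin.Subset using (Subset; _∈_; ∣_∣)
open import Data.Vec using (lookup; tabulate)
import Data.Vec as V
open import Data.Product using (Σ; ∃; _×_; _,_)
open import Relation.Nullary using (¬_)
open import Relation.Binary.PropositionalEquality using (_≡_)
open import Relation.Binary.Construct.Closure.ReflexiveTransitive using (Star)

-- A position of the game on n stacks: stack i has p i tokens.
-- Stacks are labelled (tracked by identity) throughout play.
Position : ℕ → Set
Position n = Fin n → ℕ

Σp : ∀ {n} → Position n → ℕ
Σp p = V.sum (tabulate p)

Sorted : ∀ {n} → Position n → Set
Sorted {n} p = ∀ (i j : Fin n) → i F.≤ j → p i ≤ p j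

MoveBy : ∀ {n} → ℕ → Position n → Position n → Set
MoveBy {n} ℓ p q =
  Σ (Subset n) λ S →
    (∣ S ∣ ≡ ℓ) ×
    (∀ i → i ∈ S → 1 ≤ p i) ×
    (∀ i → q i ≡ (if lookup S i then p i ∸ 1 else p i))

Move : ∀ {n} → (ℕ → Set) → Position n → Position n → Set
Move A p q = ∃ λ ℓ → A ℓ × MoveBy ℓ p q

Reach : ∀ {n} → (ℕ → Set) → Position n → Position n → Set
Reach A = Star (Move A)

Terminal : ∀ {n} → (ℕ → Set) → Position n → Set
Terminal A t = ¬ (∃ λ q → Move A t q)

InT : ∀ {n} → (ℕ → Set) → Position n → Position n → Set
InT A p t = Reach A p t × Terminal A t

IsU : ∀ {n} → (ℕ → Set) → Position n → Fin n → ℕ → Set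
IsU A p i m =
  (∃ λ t → InT A p t × (t i ≡ m)) × (∀ t → InT A p t → m ≤ t i)

Reduced : ∀ {n} → (ℕ → Set) → Position n → Set
Reduced {n} A p =
  Σ (Position n) λ u → (∀ i → IsU A p i (u i)) × (∀ i → p i ∸ u i ≡ p i)

Single : ℕ → ℕ → Set
Single k ℓ = ℓ ≡ k

-- Every move of SN(n,k) removes k tokens and takes at most one from each stack,
-- so emptying stack i costs at least p_i moves, that is k·p_i tokens: a reduced
-- position has k·p_n ≤ Σ(p). Conversely, write Σ(p) = kQ + R with R < k, so that
-- every p_j ≤ Q. Set aside R tokens outside stack i and play the remaining kQ
-- in Q rounds, each taking one token from k stacks including all the highest
-- ones; the maximum then drops by one per round and the R leftover tokens form
-- a terminal position in which stack i is empty.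
module Submission where

open import Defs
open import Data.Nat
open import Data.Nat.Properties
open import Data.Nat.DivMod using (_/_; _%_; m≡m%n+[m/n]*n; m%n<n; m*n/n≡m; /-monoˡ-≤)
open import Data.Bool using (true; false; if_then_else_)
open import Data.Fin using (Fin; zero; suc; fromℕ)
open import Data.Fin.Properties using (≤fromℕ)
open import Data.Fin.Subset using (Subset; inside; outside; _∈_; _∉_; _⊆_; ∣_∣)
open import Data.Fin.Subset.Properties
  using (⊆-refl; drop-∷-⊆; drop-there; in⊆in; out⊆; p⊆q⇒∣p∣≤∣q∣)
open import Data.Vec using ([]; _∷_; here; there; lookup; tabulate)
import Data.Vec as V
open import Data.Vec.Properties using ([]=⇒lookup; lookup⇒[]=; lookup∘tabulate; tabulate-cong)
open import Data.Vec.Functional using (updateAt)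
open import Data.Vec.Functional.Properties using (updateAt-updates)
open import Data.Product using (∃; _×_; _,_; proj₁)
open import Function using (_∘_)
open import Function.Bundles using (_⇔_; mk⇔)
open import Level using (0ℓ)
open import Relation.Binary.PropositionalEquality
open import Relation.Binary.Construct.Closure.ReflexiveTransitive using (ε; _◅_)
open import Relation.Nullary using (does; yes; no; contradiction)
open import Relation.Nullary.Decidable using (dec-true)
open import Relation.Unary using (Pred; Decidable)
open import Algebra.Properties.CommutativeSemigroup +-commutativeSemigroup using (interchange; x∙yz≈y∙xz)

private
  variable
    n : ℕ

⟦_⟧ : {P : Pred (Fin n) 0ℓ} → Decidable P → Subset n
⟦ P? ⟧ = tabulate (does ∘ P?)

∈⟦⟧⁺ : {P : Pred (Fin n) 0ℓ} (P? : Decidable P) {j : Fin n} → P j → j ∈ ⟦ P? ⟧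
∈⟦⟧⁺ P? {j} pj = lookup⇒[]= j _ (trans (lookup∘tabulate _ j) (dec-true (P? j) pj))

∈⟦⟧⁻ : {P : Pred (Fin n) 0ℓ} (P? : Decidable P) {j : Fin n} → j ∈ ⟦ P? ⟧ → P j
∈⟦⟧⁻ P? {j} j∈ with P? j | trans (sym (lookup∘tabulate (does ∘ P?) j)) ([]=⇒lookup j∈)
... | yes pj | _ = pj
... | no _   | ()

subset-between : ∀ {F N : Subset n} k → F ⊆ N → ∣ F ∣ ≤ k → k ≤ ∣ N ∣ →
  ∃ λ S → F ⊆ S × S ⊆ N × ∣ S ∣ ≡ k
subset-between {F = []} {[]} k _ _ k≤0 = [] , ⊆-refl , ⊆-refl , sym (n≤0⇒n≡0 k≤0)
subset-between {F = inside ∷ F} {outside ∷ N} k F⊆N _ _ = contradiction (F⊆N here) λ ()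
subset-between {F = inside ∷ F} {inside ∷ N} (suc k) F⊆N (s≤s ∣F∣≤k) (s≤s k≤∣N∣)
  with subset-between k (drop-∷-⊆ F⊆N) ∣F∣≤k k≤∣N∣
... | S , F⊆S , S⊆N , ∣S∣≡k = inside ∷ S , in⊆in F⊆S , in⊆in S⊆N , cong suc ∣S∣≡k
subset-between {F = outside ∷ F} {outside ∷ N} k F⊆N ∣F∣≤k k≤∣N∣
  with subset-between k (drop-∷-⊆ F⊆N) ∣F∣≤k k≤∣N∣
... | S , F⊆S , S⊆N , ∣S∣≡k = outside ∷ S , out⊆ F⊆S , out⊆ S⊆N , ∣S∣≡k
subset-between {F = outside ∷ F} {inside ∷ N} k F⊆N ∣F∣≤k k≤1+∣N∣ with k ≤? ∣ N ∣
... | yes k≤∣N∣ with subset-between k (drop-∷-⊆ F⊆N) ∣F∣≤k k≤∣N∣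
...   | S , F⊆S , S⊆N , ∣S∣≡k = outside ∷ S , out⊆ F⊆S , out⊆ S⊆N , ∣S∣≡k
subset-between {F = outside ∷ F} {inside ∷ N} k F⊆N ∣F∣≤k k≤1+∣N∣
  | no k≰∣N∣ with ≤-antisym k≤1+∣N∣ (≰⇒> k≰∣N∣)
... | refl with subset-between ∣ N ∣ (drop-∷-⊆ F⊆N) (p⊆q⇒∣p∣≤∣q∣ (drop-∷-⊆ F⊆N)) ≤-refl
...   | S , F⊆S , S⊆N , ∣S∣≡∣N∣ = inside ∷ S , out⊆ F⊆S , in⊆in S⊆N , cong suc ∣S∣≡∣N∣

Σp-cong : {f g : Position n} → (∀ i → f i ≡ g i) → Σp f ≡ Σp g
Σp-cong = cong V.sum ∘ tabulate-cong

Σp-split : ∀ (p d e : Position n) → (∀ j → p j ≡ d j + e j) → Σp p ≡ Σp d + Σp e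
Σp-split {zero} p d e _ = refl
Σp-split {suc n} p d e p≡ =
  trans (cong₂ _+_ (p≡ zero) (Σp-split (p ∘ suc) (d ∘ suc) (e ∘ suc) (p≡ ∘ suc)))
        (interchange (d zero) (e zero) (Σp (d ∘ suc)) (Σp (e ∘ suc)))

Σp-updateAt-zero : ∀ (p : Position n) i → Σp (updateAt p i (λ _ → 0)) + p i ≡ Σp p
Σp-updateAt-zero p zero = +-comm (Σp (p ∘ suc)) (p zero)
Σp-updateAt-zero p (suc i) =
  trans (+-assoc (p zero) _ (p (suc i))) (cong (p zero +_) (Σp-updateAt-zero (p ∘ suc) i))

updateAt-zero-≤ : ∀ (p : Position n) i j → updateAt p i (λ _ → 0) j ≤ p j
updateAt-zero-≤ p zero    zero    = z≤n
updateAt-zero-≤ p zero    (suc j) = ≤-refl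
updateAt-zero-≤ p (suc i) zero    = ≤-refl
updateAt-zero-≤ p (suc i) (suc j) = updateAt-zero-≤ (p ∘ suc) i j

bounded-subposition : ∀ (q : Position n) r → r ≤ Σp q →
  ∃ λ e → (∀ j → e j ≤ q j) × Σp e ≡ r
bounded-subposition {zero} q r r≤0 = (λ ()) , (λ ()) , sym (n≤0⇒n≡0 r≤0)
bounded-subposition {suc n} q r r≤Σq
  with bounded-subposition (q ∘ suc) (r ∸ q zero) (m≤n+o⇒m∸n≤o r (q zero) r≤Σq)
... | e , e≤q , Σe≡ = e′ , e′≤q , trans (cong (q zero ⊓ r +_) Σe≡) (m⊓n+n∸m≡n (q zero) r)
  where
  e′ : Position (suc n)
  e′ zero    = q zero ⊓ r
  e′ (suc j) = e j
  e′≤q : ∀ j → e′ j ≤ q j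
  e′≤q zero    = m⊓n≤m (q zero) r
  e′≤q (suc j) = e≤q j

∣S∣*M≤Σp : ∀ (S : Subset n) (d : Position n) {M} → (∀ j → j ∈ S → M ≤ d j) → ∣ S ∣ * M ≤ Σp d
∣S∣*M≤Σp [] d _ = z≤n
∣S∣*M≤Σp (inside ∷ S) d M≤d =
  +-mono-≤ (M≤d zero here) (∣S∣*M≤Σp S (d ∘ suc) (λ j → M≤d (suc j) ∘ there))
∣S∣*M≤Σp (outside ∷ S) d M≤d =
  ≤-trans (∣S∣*M≤Σp S (d ∘ suc) (λ j → M≤d (suc j) ∘ there)) (m≤n+m _ (d zero))

Σp≤∣S∣*M : ∀ (S : Subset n) (d : Position n) {M} →
  (∀ j → d j ≤ M) → (∀ j → j ∉ S → d j ≡ 0) → Σp d ≤ ∣ S ∣ * M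
Σp≤∣S∣*M [] d _ _ = z≤n
Σp≤∣S∣*M (inside ∷ S) d d≤M d≡0 =
  +-mono-≤ (d≤M zero) (Σp≤∣S∣*M S (d ∘ suc) (d≤M ∘ suc) (λ j j∉S → d≡0 (suc j) (j∉S ∘ drop-there)))
Σp≤∣S∣*M (outside ∷ S) d d≤M d≡0 rewrite d≡0 zero λ () =
  Σp≤∣S∣*M S (d ∘ suc) (d≤M ∘ suc) (λ j j∉S → d≡0 (suc j) (j∉S ∘ drop-there))

decrement : Subset n → Position n → Position n
decrement S p i = if lookup S i then p i ∸ 1 else p i

Σp-decrement : ∀ (S : Subset n) (p : Position n) → (∀ i → i ∈ S → 1 ≤ p i) →
  Σp p ≡ ∣ S ∣ + Σp (decrement S p)
Σp-decrement [] p _ = refl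
Σp-decrement (outside ∷ S) p pos =
  trans (cong (p zero +_) (Σp-decrement S (p ∘ suc) (λ i → pos (suc i) ∘ there)))
        (x∙yz≈y∙xz (p zero) ∣ S ∣ _)
Σp-decrement (inside ∷ S) p pos with p zero | pos zero here
... | suc a | _ =
  cong suc (trans (cong (a +_) (Σp-decrement S (p ∘ suc) (λ i → pos (suc i) ∘ there)))
                  (x∙yz≈y∙xz a ∣ S ∣ _))

move-sum : ∀ {ℓ} {p q : Position n} → MoveBy ℓ p q → Σp p ≡ ℓ + Σp q
move-sum {p = p} (S , refl , pos , q≡) =
  trans (Σp-decrement S p pos) (cong (∣ S ∣ +_) (Σp-cong (sym ∘ q≡)))

move-decrease : ∀ {ℓ} {p q : Position n} → MoveBy ℓ p q → ∀ j → p j ≤ suc (q j)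
move-decrease {p = p} (S , _ , _ , q≡) j rewrite q≡ j with lookup S j
... | true  = m≤n+m∸n (p j) 1
... | false = n≤1+n (p j)

small⇒terminal : ∀ k {t : Position n} → Σp t < k → Terminal (Single k) t
small⇒terminal k Σt<k (q , _ , refl , move) =
  <⇒≱ Σt<k (≤-trans (m≤m+n k (Σp q)) (≤-reflexive (sym (move-sum move))))

reach-rounds : ∀ k {p t : Position n} → Reach (Single k) p t →
  ∃ λ M → Σp p ≡ k * M + Σp t × (∀ j → p j ≤ M + t j)
reach-rounds k {p} ε = 0 , cong (_+ Σp p) (sym (*-zeroʳ k)) , λ _ → ≤-refl
reach-rounds k {p} {t} ((_ , refl , move) ◅ rest) =
  let M , Σq≡ , q≤ = reach-rounds k rest
      open ≡-Reasoning
  in suc M ,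
     (begin
       Σp p                 ≡⟨ move-sum move ⟩
       k + _                ≡⟨ cong (k +_) Σq≡ ⟩
       k + (k * M + Σp t)   ≡⟨ +-assoc k (k * M) (Σp t) ⟨
       k + k * M + Σp t     ≡⟨ cong (_+ Σp t) (*-suc k M) ⟨
       k * suc M + Σp t     ∎) ,
     λ j → ≤-trans (move-decrease move j) (s≤s (q≤ j))

reach-loss : ∀ k {p t : Position n} → Reach (Single k) p t → ∀ j → k * (p j ∸ t j) ≤ Σp p
reach-loss k {p} {t} reach j =
  let M , Σp≡ , p≤ = reach-rounds k reach
      open ≤-Reasoning
  in begin
    k * (p j ∸ t j) ≤⟨ *-monoʳ-≤ k (m≤n+o⇒m∸n≤o (p j) (t j) (subst (p j ≤_) (+-comm M (t j)) (p≤ j))) ⟩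
    k * M           ≤⟨ m≤m+n (k * M) (Σp t) ⟩
    k * M + Σp t    ≡⟨ Σp≡ ⟨
    Σp p            ∎

cover-maxima : ∀ k Q (d : Position n) → (∀ j → d j ≤ suc Q) → Σp d ≡ k * suc Q →
  ∃ λ S → ∣ S ∣ ≡ k × (∀ j → j ∈ S → 1 ≤ d j) × (∀ j → j ∉ S → d j ≤ Q)
cover-maxima k Q d d≤ Σd≡ =
  let S , F⊆S , S⊆N , ∣S∣≡k = subset-between k F⊆N ∣F∣≤k k≤∣N∣
  in S , ∣S∣≡k , (λ j → ∈⟦⟧⁻ pos? ∘ S⊆N) ,
     λ j j∉S → s≤s⁻¹ (≤∧≢⇒< (d≤ j) (j∉S ∘ F⊆S ∘ ∈⟦⟧⁺ max?))
  where
  max? : Decidable (λ j → d j ≡ suc Q)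
  max? j = d j ≟ suc Q
  pos? : Decidable (λ j → 1 ≤ d j)
  pos? j = 1 ≤? d j
  F N : Subset _
  F = ⟦ max? ⟧
  N = ⟦ pos? ⟧
  F⊆N : F ⊆ N
  F⊆N j∈F = ∈⟦⟧⁺ pos? (subst (1 ≤_) (sym (∈⟦⟧⁻ max? j∈F)) (s≤s z≤n))
  ∣F∣≤k : ∣ F ∣ ≤ k
  ∣F∣≤k = *-cancelʳ-≤ ∣ F ∣ k (suc Q)
    (subst (∣ F ∣ * suc Q ≤_) Σd≡ (∣S∣*M≤Σp F d (λ j j∈F → ≤-reflexive (sym (∈⟦⟧⁻ max? j∈F)))))
  k≤∣N∣ : k ≤ ∣ N ∣
  k≤∣N∣ = *-cancelʳ-≤ k ∣ N ∣ (suc Q)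
    (subst (_≤ ∣ N ∣ * suc Q) Σd≡ (Σp≤∣S∣*M N d d≤ (λ j j∉N → n<1⇒n≡0 (≰⇒> (j∉N ∘ ∈⟦⟧⁺ pos?)))))

-- The endpoint is only pointwise equal to e, as there is no function extensionality.
drain : ∀ k Q (d e p : Position n) → (∀ j → p j ≡ d j + e j) →
  (∀ j → d j ≤ Q) → Σp d ≡ k * Q →
  ∃ λ t → Reach (Single k) p t × (∀ j → t j ≡ e j)
drain k zero d e p p≡ d≤0 _ = p , ε , λ j → trans (p≡ j) (cong (_+ e j) (n≤0⇒n≡0 (d≤0 j)))
drain k (suc Q) d e p p≡ d≤ Σd≡ with cover-maxima k Q d d≤ Σd≡
... | S , ∣S∣≡k , d-pos , rest≤Q =
  let t , reach , t≡e = drain k Q (decrement S d) e _ (λ _ → refl) d′≤Q Σd′≡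
  in t , (k , refl , S , ∣S∣≡k , p-pos , step) ◅ reach , t≡e
  where
  d′≤Q : ∀ j → decrement S d j ≤ Q
  d′≤Q j with lookup S j in eq
  ... | true  = ∸-monoˡ-≤ 1 (d≤ j)
  ... | false = rest≤Q j (λ j∈S → contradiction (trans (sym ([]=⇒lookup j∈S)) eq) λ ())
  Σd′≡ : Σp (decrement S d) ≡ k * Q
  Σd′≡ = +-cancelˡ-≡ k _ _ (begin
    k + Σp (decrement S d)        ≡⟨ cong (_+ _) ∣S∣≡k ⟨
    ∣ S ∣ + Σp (decrement S d)    ≡⟨ Σp-decrement S d d-pos ⟨
    Σp d                          ≡⟨ trans Σd≡ (*-suc k Q) ⟩
    k + k * Q                     ∎)
    where open ≡-Reasoning
  p-pos : ∀ j → j ∈ S → 1 ≤ p j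
  p-pos j j∈S = ≤-trans (d-pos j j∈S) (subst (d j ≤_) (sym (p≡ j)) (m≤m+n (d j) (e j)))
  step : ∀ j → decrement S d j + e j ≡ (if lookup S j then p j ∸ 1 else p j)
  step j rewrite p≡ j with lookup S j in eq
  ... | true  = sym (+-∸-comm (e j) (d-pos j (lookup⇒[]= j S eq)))
  ... | false = refl

play-down-to : ∀ k Q (p e : Position n) → (∀ j → p j ≤ Q) → (∀ j → e j ≤ p j) →
  Σp p ≡ k * Q + Σp e → Σp e < k → ∃ λ t → InT (Single k) p t × (∀ j → t j ≡ e j)
play-down-to k Q p e p≤Q e≤p Σp≡ Σe<k =
  let t , reach , t≡e = drain k Q d e p p≡ d≤Q Σd≡
  in t , (reach , small⇒terminal k (subst (_< k) (sym (Σp-cong t≡e)) Σe<k)) , t≡e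
  where
  d : Position _
  d j = p j ∸ e j
  p≡ : ∀ j → p j ≡ d j + e j
  p≡ j = sym (m∸n+n≡m (e≤p j))
  d≤Q : ∀ j → d j ≤ Q
  d≤Q j = ≤-trans (m∸n≤m (p j) (e j)) (p≤Q j)
  Σd≡ : Σp d ≡ k * Q
  Σd≡ = +-cancelʳ-≡ (Σp e) _ _ (trans (sym (Σp-split p d e p≡)) Σp≡)

emptiable : ∀ k .{{_ : NonZero k}} (p : Position n) → (∀ j → k * p j ≤ Σp p) →
  ∀ i → ∃ λ t → InT (Single k) p t × t i ≡ 0
emptiable k p small i =
  let e , e≤cap , Σe≡R = bounded-subposition cap R R≤Σcap
      e≤p j = ≤-trans (e≤cap j) (updateAt-zero-≤ p i j)
      t , inT , t≡e = play-down-to k Q p e p≤Q e≤p (trans Σp≡ (cong (k * Q +_) (sym Σe≡R)))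
                                   (subst (_< k) (sym Σe≡R) (m%n<n (Σp p) k))
  in t , inT , trans (t≡e i) (n≤0⇒n≡0 (subst (e i ≤_) (updateAt-updates i p) (e≤cap i)))
  where
  Q R : ℕ
  Q = Σp p / k
  R = Σp p % k
  cap : Position _
  cap = updateAt p i (λ _ → 0)
  p≤Q : ∀ j → p j ≤ Q
  p≤Q j = subst (_≤ Q) (m*n/n≡m (p j) k) (/-monoˡ-≤ k (subst (_≤ Σp p) (*-comm k (p j)) (small j)))
  Σp≡ : Σp p ≡ k * Q + R
  Σp≡ = trans (m≡m%n+[m/n]*n (Σp p) k) (trans (+-comm R (Q * k)) (cong (_+ R) (*-comm Q k)))
  R≤Σcap : R ≤ Σp cap
  R≤Σcap = +-cancelʳ-≤ (p i) _ _ (begin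
    R + p i         ≤⟨ +-monoʳ-≤ R (≤-trans (p≤Q i) (m≤m*n Q k)) ⟩
    R + Q * k       ≡⟨ m≡m%n+[m/n]*n (Σp p) k ⟨
    Σp p            ≡⟨ Σp-updateAt-zero p i ⟨
    Σp cap + p i    ∎)
    where open ≤-Reasoning

reduced⇒bounded : ∀ k {p : Position n} → Reduced (Single k) p → ∀ i → k * p i ≤ Σp p
reduced⇒bounded k {p} (u , isU , p∸u≡p) i =
  let t , (reach , _) , t≡u = proj₁ (isU i)
  in subst (λ x → k * x ≤ Σp p) (trans (cong (p i ∸_) t≡u) (p∸u≡p i)) (reach-loss k reach i)

emptiable⇒reduced : ∀ {A} {p : Position n} → (∀ i → ∃ λ t → InT A p t × t i ≡ 0) → Reduced A p
emptiable⇒reduced empty = (λ _ → 0) , (λ i → empty i , λ _ _ → z≤n) , λ _ → refl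

theorem2 : (m k : ℕ) → 3 ≤ suc m → 1 ≤ k → k ≤ suc m →
    (p : Position (suc m)) → Sorted p →
    Reduced (Single k) p ⇔ (k * p (fromℕ m) ≤ Σp p)
theorem2 m k _ 1≤k _ p sorted =
  mk⇔ (λ reduced → reduced⇒bounded k reduced (fromℕ m))
      (λ bound → emptiable⇒reduced (emptiable k {{>-nonZero 1≤k}} p (λ j →
        ≤-trans (*-monoʳ-≤ k (sorted j (fromℕ m) (≤fromℕ j))) bound)))
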